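{- Let $s,t$ be positive integers. Consider the following two-player game played on two heaps of finitely many tokens, containing $x$ and $y$ tokens. The players alternate moves; a move is of one of two types: (I) remove any positive number of tokens from a single heap (possibly the entire heap); (II) remove $k>0$ tokens from one heap and $l>0$ tokens from the other, where, writing the two amounts so that $k\le l$, the condition $0<k\le l<sk+t$ holds. The player who makes the last move (after which both heaps are empty) wins. Define sequences $(A_n)_{n\ge 0}$, $(B_n)_{n\ge 0}$ by $$A_n=\operatorname{mex}\{A_i,B_i:0\le i<n\},\qquad B_n=sA_n+tn\qquad(n\ge 0).$$ Then the set of $P$-positions of this game is exactly $\bigcup_{i=0}^{\infty}\{(A_i,B_i)\}$; that is, a position with heap sizes $x\le y$ is a $P$-position if and only if $(x,y)=(A_i,B_i)$ for some $i\ge 0$. -}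

module Defs where

open import Data.Nat using (ℕ; zero; suc; _+_; _*_; _∸_; _≤_; _<_)
open import Data.Nat.Properties using (_≟_)
open import Data.List using (List; []; _∷_; length)
open import Data.List.Relation.Unary.Any using (any?)
open import Data.Product using (_×_)
open import Data.Sum using (_⊎_)
open import Relation.Binary.PropositionalEquality using (_≡_)
open import Relation.Nullary using (yes; no)

-- Searching upward from m with fuel; fuel (suc (length l)) starting at 0
-- always suffices since the mex of l is at most length l.

mexFrom : ℕ → ℕ → List ℕ → ℕ
mexFrom zero    m l = m
mexFrom (suc f) m l with any? (m ≟_) l
... | yes _ = mexFrom f (suc m) l
... | no  _ = m

mex : List ℕ → ℕ
mex l = mexFrom (suc (length l)) 0 l

hist : ℕ → ℕ → ℕ → List ℕ
hist s t zero    = []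
hist s t (suc n) = mex (hist s t n) ∷ (s * mex (hist s t n) + t * n) ∷ hist s t n

A : ℕ → ℕ → ℕ → ℕ
A s t n = mex (hist s t n)

B : ℕ → ℕ → ℕ → ℕ
B s t n = s * A s t n + t * n

-- Type II: remove k = x ∸ x' > 0 from the first heap and l = y ∸ y' > 0
-- from the second, where the smaller of k, l (call it k) and the larger
-- (call it l) satisfy l < s k + t.

Move : (s t : ℕ) → ℕ → ℕ → ℕ → ℕ → Set
Move s t x y x' y' =
    (x' < x × y' ≡ y)
  ⊎ (x' ≡ x × y' < y)
  ⊎ (x' < x × y' < y
      × ((x ∸ x') ≤ (y ∸ y') → (y ∸ y') < s * (x ∸ x') + t)
      × ((y ∸ y') ≤ (x ∸ x') → (x ∸ x') < s * (y ∸ y') + t))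

-- The game is finite (every move decreases x + y), so the inductive
-- definition below captures the usual notions:
-- a position is P iff every move leads to an N-position,
-- a position is N iff some move leads to a P-position.

data IsP (s t : ℕ) (x y : ℕ) : Set
data IsN (s t : ℕ) (x y : ℕ) : Set

data IsP s t x y where
  allToN : (∀ x' y' → Move s t x y x' y' → IsN s t x' y') → IsP s t x y

data IsN s t x y where
  someToP : ∀ x' y' → Move s t x y x' y' → IsP s t x' y' → IsN s t x y

{-# OPTIONS --safe #-}
module Submission where

-- The pairs (A i , B i) together with their mirror images form a kernel of the game graph (no
-- move joins two of them, and every other position has a move into one), and in a finite game the
-- kernel is exactly the set of P-positions. Since A and B are strictly increasing and cover every
-- natural number exactly once (apart from A 0 = B 0 = 0), a move between kernel positions cannot
-- keep a heap, so it is of type II; but going down from (A i , B i) to (A j , B j) or (B j , A j)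
-- with j < i removes k from one heap and at least s k + t from the other. Conversely, if
-- A i ≤ y < B i then y − A i lies between the gaps B j − A j and B (j+1) − A (j+1) for some j < i,
-- which is exactly what makes (A i , y) → (A j , B j) a legal type II move.

open import Defs
open import Data.Nat using (ℕ; zero; suc; _+_; _*_; _∸_; _≤_; _<_; z≤n; s≤s; z<s; _≤?_; _<?_)
open import Data.Nat.Properties
open import Data.Nat.Induction using (<-wellFounded)
open import Data.Nat.Tactic.RingSolver using (solve-∀)
open import Data.Fin using (Fin; toℕ)
import Data.Fin.Properties as Fin
open import Data.List using (List; length; lookup)
open import Data.List.Relation.Unary.Any using (here; there; index; any?)
open import Data.List.Relation.Unary.Any.Properties using (lookup-index)
open import Data.List.Membership.Propositional using (_∈_; _∉_)
open import Data.Product using (_×_; _,_; ∃; ∃₂)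
open import Data.Sum as Sum using (_⊎_; inj₁; inj₂)
open import Function using (_∘_)
open import Function.Bundles using (_⇔_; mk⇔)
open import Function.Definitions using (Injective)
open import Induction.WellFounded using (Acc; acc)
open import Relation.Binary.Definitions using (Monotonic₁; tri<; tri≈; tri>)
open import Relation.Binary.PropositionalEquality
  using (_≡_; refl; sym; trans; cong; cong₂; subst; module ≡-Reasoning)
open import Relation.Nullary using (¬_; yes; no; contradiction)

module _ {s t : ℕ} where

  Move-swap : ∀ {x y x' y'} → Move s t x y x' y' → Move s t y x y' x'
  Move-swap (inj₁ (x'<x , refl))                 = inj₂ (inj₁ (refl , x'<x))
  Move-swap (inj₂ (inj₁ (refl , y'<y)))          = inj₁ (y'<y , refl)
  Move-swap (inj₂ (inj₂ (x'<x , y'<y , kl , lk))) = inj₂ (inj₂ (y'<y , x'<x , lk , kl))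

  move-decreases : ∀ {x y x' y'} → Move s t x y x' y' → x' + y' < x + y
  move-decreases {y = y} (inj₁ (x'<x , refl))         = +-monoˡ-< y x'<x
  move-decreases {x = x} (inj₂ (inj₁ (refl , y'<y)))  = +-monoʳ-< x y'<y
  move-decreases (inj₂ (inj₂ (x'<x , y'<y , _ , _))) = +-mono-< x'<x y'<y

  typeII : ∀ {x y x' y'} k l → x' + k ≡ x → y' + l ≡ y → 0 < k → 0 < l →
           (k ≤ l → l < s * k + t) → (l ≤ k → k < s * l + t) → Move s t x y x' y'
  typeII {x' = x'} {y' = y'} k l refl refl 0<k 0<l kl lk
    rewrite m+n∸m≡n x' k | m+n∸m≡n y' l = inj₂ (inj₂ (m<m+n x' 0<k , m<m+n y' 0<l , kl , lk))

  IsP⇒¬IsN : ∀ {x y} → IsP s t x y → ¬ IsN s t x y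
  IsP⇒¬IsN (allToN toN) (someToP x' y' m p) = IsP⇒¬IsN p (toN x' y' m)

module KernelCharacterisation {s t : ℕ} (K : ℕ → ℕ → Set)
  (stable : ∀ {x y x' y'} → K x y → K x' y' → ¬ Move s t x y x' y')
  (absorbing : ∀ x y → K x y ⊎ ∃₂ λ x' y' → Move s t x y x' y' × K x' y')
  where

  kernel⇒IsP : ∀ {x y} → K x y → IsP s t x y
  kernel⇒IsP = go (<-wellFounded _)
    where
    go : ∀ {x y} → Acc _<_ (x + y) → K x y → IsP s t x y
    go {x} {y} (acc rec) k = allToN toN
      where
      toN : ∀ x' y' → Move s t x y x' y' → IsN s t x' y'
      toN x' y' m with absorbing x' y'
      ... | inj₁ k' = contradiction m (stable k k')
      ... | inj₂ (x'' , y'' , m' , k'') = someToP x'' y'' m' (go (rec x''+y''<x+y) k'')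
        where
        x''+y''<x+y : x'' + y'' < x + y
        x''+y''<x+y = <-trans (move-decreases {s} {t} m') (move-decreases {s} {t} m)

  IsP⇒kernel : ∀ {x y} → IsP s t x y → K x y
  IsP⇒kernel {x} {y} p with absorbing x y
  ... | inj₁ k = k
  ... | inj₂ (x' , y' , m , k') = contradiction (someToP x' y' m (kernel⇒IsP k')) (IsP⇒¬IsN p)

Covers : List ℕ → ℕ → Set
Covers l m = ∀ k → k < m → k ∈ l

covers-suc : ∀ {l m} → Covers l m → m ∈ l → Covers l (suc m)
covers-suc {m = m} cov m∈l k (s≤s k≤m) with m≤n⇒m<n∨m≡n k≤m
... | inj₁ k<m  = cov k k<m
... | inj₂ refl = m∈l

¬covers-suc-length : ∀ l → ¬ Covers l (suc (length l))
¬covers-suc-length l cov =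
  let i , j , i<j , same-position = Fin.pigeonhole (n<1+n (length l)) position
  in Fin.<⇒≢ i<j (position-injective same-position)
  where
  open ≡-Reasoning
  occurs : (i : Fin (suc (length l))) → toℕ i ∈ l
  occurs i = cov (toℕ i) (Fin.toℕ<n i)
  position : Fin (suc (length l)) → Fin (length l)
  position = index ∘ occurs
  position-injective : Injective _≡_ _≡_ position
  position-injective {i} {j} same-position = Fin.toℕ-injective (begin
    toℕ i                  ≡⟨ lookup-index (occurs i) ⟩
    lookup l (position i)  ≡⟨ cong (lookup l) same-position ⟩
    lookup l (position j)  ≡⟨ lookup-index (occurs j) ⟨
    toℕ j                  ∎)

mexFrom-covers : ∀ f {m l} → Covers l m → Covers l (mexFrom f m l)
mexFrom-covers zero    cov = cov
mexFrom-covers (suc f) {m} {l} cov with any? (m ≟_) l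
... | yes m∈l = mexFrom-covers f (covers-suc cov m∈l)
... | no  _   = cov

mexFrom-∉ : ∀ f {m l} → Covers l m → m + f ≡ suc (length l) → mexFrom f m l ∉ l
mexFrom-∉ zero    {m} {l} cov m+0≡ _ =
  ¬covers-suc-length l (subst (Covers l) (trans (sym (+-identityʳ m)) m+0≡) cov)
mexFrom-∉ (suc f) {m} {l} cov m+f≡ with any? (m ≟_) l
... | yes m∈l = mexFrom-∉ f (covers-suc cov m∈l) (trans (sym (+-suc m f)) m+f≡)
... | no  m∉l = m∉l

mex-covers : ∀ l → Covers l (mex l)
mex-covers l = mexFrom-covers (suc (length l)) (λ _ ())

mex-∉ : ∀ l → mex l ∉ l
mex-∉ l = mexFrom-∉ (suc (length l)) (λ _ ()) refl

covers⇒≤mex : ∀ {l m} → Covers l m → m ≤ mex l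
covers⇒≤mex {l} cov = ≮⇒≥ λ mex<m → mex-∉ l (cov (mex l) mex<m)

module _ {f : ℕ → ℕ} where

  suc-<⇒strictMono : (∀ n → f n < f (suc n)) → Monotonic₁ _<_ _<_ f
  suc-<⇒strictMono f-suc {i} {suc j} (s≤s i≤j) with m≤n⇒m<n∨m≡n i≤j
  ... | inj₁ i<j  = <-trans (suc-<⇒strictMono f-suc i<j) (f-suc j)
  ... | inj₂ refl = f-suc j

  strictMono⇒mono : Monotonic₁ _<_ _<_ f → Monotonic₁ _≤_ _≤_ f
  strictMono⇒mono mono i≤j with m≤n⇒m<n∨m≡n i≤j
  ... | inj₁ i<j  = <⇒≤ (mono i<j)
  ... | inj₂ refl = ≤-refl

  strictMono⇒reflects-< : Monotonic₁ _<_ _<_ f → ∀ {i j} → f i < f j → i < j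
  strictMono⇒reflects-< mono fi<fj = ≰⇒> λ j≤i → <⇒≱ fi<fj (strictMono⇒mono mono j≤i)

  strictMono⇒injective : Monotonic₁ _<_ _<_ f → Injective _≡_ _≡_ f
  strictMono⇒injective mono {i} {j} fi≡fj with <-cmp i j
  ... | tri< i<j _ _ = contradiction fi≡fj (<⇒≢ (mono i<j))
  ... | tri≈ _ i≡j _ = i≡j
  ... | tri> _ _ j<i = contradiction (sym fi≡fj) (<⇒≢ (mono j<i))

  strictMono⇒inflationary : Monotonic₁ _<_ _<_ f → ∀ n → n ≤ f n
  strictMono⇒inflationary mono zero    = z≤n
  strictMono⇒inflationary mono (suc n) = ≤-<-trans (strictMono⇒inflationary mono n) (mono (n<1+n n))

crossing : ∀ (f : ℕ → ℕ) {d i} → f 0 ≤ d → d < f i → ∃ λ j → j < i × f j ≤ d × d < f (suc j)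
crossing f {i = zero}  f0≤d d<f0 = contradiction f0≤d (<⇒≱ d<f0)
crossing f {d} {suc i} f0≤d d<f[1+i] with d <? f i
... | yes d<fi with j , j<i , bracket ← crossing f f0≤d d<fi = j , m<n⇒m<1+n j<i , bracket
... | no  d≮fi = i , n<1+n i , ≮⇒≥ d≮fi , d<f[1+i]

module Sequences (s' t' : ℕ) where

  s t : ℕ
  s = suc s'
  t = suc t'

  a b gap : ℕ → ℕ
  a = A s t
  b = B s t
  gap j = s' * a j + t * j

  b≡a+gap : ∀ j → b j ≡ a j + gap j
  b≡a+gap j = +-assoc (a j) (s' * a j) (t * j)

  gap-zero : gap 0 ≡ 0
  gap-zero = cong₂ _+_ (*-zeroʳ s') (*-zeroʳ t)

  b-zero : b 0 ≡ 0
  b-zero = trans (b≡a+gap 0) gap-zero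

  n<s*n+t : ∀ n → n < s * n + t
  n<s*n+t n = ≤-<-trans (m≤m+n n (s' * n)) (m<m+n (s * n) z<s)

  ∈hist⇒a∨b : ∀ n {v} → v ∈ hist s t n → ∃ λ i → v ≡ a i ⊎ v ≡ b i
  ∈hist⇒a∨b zero    ()
  ∈hist⇒a∨b (suc n) (here v≡a)          = n , inj₁ v≡a
  ∈hist⇒a∨b (suc n) (there (here v≡b))  = n , inj₂ v≡b
  ∈hist⇒a∨b (suc n) (there (there v∈h)) = ∈hist⇒a∨b n v∈h

  b∈hist : ∀ {i n} → i < n → b i ∈ hist s t n
  b∈hist {n = suc n} (s≤s i≤n) with m≤n⇒m<n∨m≡n i≤n
  ... | inj₁ i<n  = there (there (b∈hist i<n))
  ... | inj₂ refl = there (here refl)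

  a-suc : ∀ n → a n < a (suc n)
  a-suc n = covers⇒≤mex (covers-suc covers-below-a (here refl))
    where
    covers-below-a : Covers (hist s t (suc n)) (a n)
    covers-below-a k k<a = there (there (mex-covers (hist s t n) k k<a))

  a-strictMono : Monotonic₁ _<_ _<_ a
  a-strictMono = suc-<⇒strictMono a-suc

  b-strictMono : Monotonic₁ _<_ _<_ b
  b-strictMono i<j = +-mono-<-≤ (*-monoʳ-< s (a-strictMono i<j)) (*-monoʳ-≤ t (<⇒≤ i<j))

  a-or-b : ∀ m → ∃ λ i → m ≡ a i ⊎ m ≡ b i
  a-or-b m = ∈hist⇒a∨b (suc m) (mex-covers _ m (strictMono⇒inflationary a-strictMono (suc m)))

  a≤b : ∀ i → a i ≤ b i
  a≤b i = ≤-trans (m≤m+n (a i) (s' * a i)) (m≤m+n (s * a i) (t * i))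

  a<b : ∀ j → a (suc j) < b (suc j)
  a<b j = ≤-<-trans (m≤m+n (a (suc j)) (s' * a (suc j))) (m<m+n (s * a (suc j)) z<s)

  a≡b⇒zero : ∀ {i j} → a i ≡ b j → i ≡ 0 × j ≡ 0
  a≡b⇒zero {i} {zero}  ai≡b0 = strictMono⇒injective a-strictMono (trans ai≡b0 b-zero) , refl
  a≡b⇒zero {i} {suc j} ai≡bj with i ≤? suc j
  ... | yes i≤j = contradiction ai≡bj (<⇒≢ (≤-<-trans (strictMono⇒mono a-strictMono i≤j) (a<b j)))
  ... | no  i≰j =
    contradiction (b∈hist (≰⇒> i≰j)) (subst (_∉ hist s t i) ai≡bj (mex-∉ (hist s t i)))

  a≡b⇒b≡a : ∀ {i j} → a i ≡ b j → b i ≡ a j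
  a≡b⇒b≡a {i} {j} ai≡bj with a≡b⇒zero {i} {j} ai≡bj
  ... | refl , refl = b-zero

  Pair : ℕ → ℕ → Set
  Pair x y = ∃ λ i → x ≡ a i × y ≡ b i

  Kernel : ℕ → ℕ → Set
  Kernel x y = Pair x y ⊎ Pair y x

  kernel-functional : ∀ {x y y'} → Kernel x y → Kernel x y' → y ≡ y'
  kernel-functional (inj₁ (i , refl , refl)) (inj₁ (j , ai≡aj , refl)) =
    cong b (strictMono⇒injective a-strictMono {i} {j} ai≡aj)
  kernel-functional (inj₁ (i , refl , refl)) (inj₂ (j , refl , ai≡bj)) =
    a≡b⇒b≡a {i} {j} ai≡bj
  kernel-functional (inj₂ (i , refl , refl)) (inj₁ (j , bi≡aj , refl)) =
    sym (a≡b⇒b≡a {j} {i} (sym bi≡aj))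
  kernel-functional (inj₂ (i , refl , refl)) (inj₂ (j , refl , bi≡bj)) =
    cong a (strictMono⇒injective b-strictMono {i} {j} bi≡bj)

  kernel-bound : ∀ {x y} → Kernel x y → ∃ λ j → a j ≤ x × y ≤ s * x + t * j
  kernel-bound (inj₁ (j , refl , refl)) = j , ≤-refl , ≤-refl
  kernel-bound (inj₂ (j , refl , refl)) =
    j , a≤b j , ≤-trans (a≤b j) (≤-trans (m≤m+n (b j) (s' * b j)) (m≤m+n (s * b j) (t * j)))

  steep-descent : ∀ {x y x' y'} → Pair x y → Kernel x' y' → x' < x → s * (x ∸ x') + t ≤ y ∸ y'
  steep-descent {x' = x'} {y'} (i , refl , refl) K' x'<ai with kernel-bound K'
  ... | j , aj≤x' , y'≤line = m+n≤o⇒m≤o∸n (s * k + t) (begin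
    s * k + t + y'                ≤⟨ +-monoʳ-≤ (s * k + t) y'≤line ⟩
    s * k + t + (s * x' + t * j)  ≡⟨ shift-line s t k x' j ⟩
    s * (x' + k) + t * suc j      ≡⟨ cong (λ z → s * z + t * suc j) (m+[n∸m]≡n (<⇒≤ x'<ai)) ⟩
    s * a i + t * suc j           ≤⟨ +-monoʳ-≤ (s * a i) (*-monoʳ-≤ t j<i) ⟩
    b i                           ∎)
    where
    open ≤-Reasoning
    k = a i ∸ x'
    j<i : j < i
    j<i = strictMono⇒reflects-< a-strictMono (≤-<-trans aj≤x' x'<ai)
    shift-line : ∀ s t k x j → s * k + t + (s * x + t * j) ≡ s * (x + k) + t * suc j
    shift-line = solve-∀

  too-steep : ∀ {k l} → s * k + t ≤ l → ¬ (k ≤ l → l < s * k + t)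
  too-steep sk+t≤l allowed = <⇒≱ (allowed (≤-trans (<⇒≤ (n<s*n+t _)) sk+t≤l)) sk+t≤l

  kernel-stable : ∀ {x y x' y'} → Kernel x y → Kernel x' y' → ¬ Move s t x y x' y'
  kernel-stable K K' (inj₁ (x'<x , refl)) =
    <-irrefl (kernel-functional (Sum.swap K') (Sum.swap K)) x'<x
  kernel-stable K K' (inj₂ (inj₁ (refl , y'<y))) = <-irrefl (kernel-functional K' K) y'<y
  kernel-stable (inj₁ P) K' (inj₂ (inj₂ (x'<x , _ , allowed , _))) =
    too-steep (steep-descent P K' x'<x) allowed
  kernel-stable (inj₂ P) K' (inj₂ (inj₂ (_ , y'<y , _ , allowed))) =
    too-steep (steep-descent P (Sum.swap K') y'<y) allowed

  gap-step : ∀ {i j} → j < i → gap (suc j) ≤ gap j + (s' * (a i ∸ a j) + t)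
  gap-step {i} {j} j<i = begin
    s' * a (suc j) + t * suc j              ≤⟨ +-monoˡ-≤ (t * suc j) (*-monoʳ-≤ s' a[1+j]≤ai) ⟩
    s' * a i + t * suc j                    ≡⟨ cong (λ z → s' * z + t * suc j) aj+k≡ai ⟨
    s' * (a j + k) + t * suc j              ≡⟨ expand s' t (a j) k j ⟩
    s' * a j + t * j + (s' * k + t)         ∎
    where
    open ≤-Reasoning
    k = a i ∸ a j
    a[1+j]≤ai : a (suc j) ≤ a i
    a[1+j]≤ai = strictMono⇒mono a-strictMono {suc j} {i} j<i
    aj+k≡ai : a j + k ≡ a i
    aj+k≡ai = m+[n∸m]≡n (<⇒≤ (a-strictMono {j} {i} j<i))
    expand : ∀ s' t aj k j → s' * (aj + k) + t * suc j ≡ s' * aj + t * j + (s' * k + t)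
    expand = solve-∀

  crossing⇒move : ∀ {i j y} → j < i → a i + gap j ≤ y → y < a i + gap (suc j) →
                  Move s t (a i) y (a j) (b j)
  crossing⇒move {i} {j} {y} j<i lower upper =
    typeII {s} {t} k (k + e) aj+k≡ai bj+[k+e]≡y 0<k (≤-trans 0<k (m≤m+n k e))
      allowed reverse-allowed
    where
    open ≤-Reasoning
    k = a i ∸ a j
    e = y ∸ (a i + gap j)
    0<k : 0 < k
    0<k = m<n⇒0<n∸m (a-strictMono {j} {i} j<i)
    aj+k≡ai : a j + k ≡ a i
    aj+k≡ai = m+[n∸m]≡n (<⇒≤ (a-strictMono {j} {i} j<i))
    e<s'k+t : e < s' * k + t
    e<s'k+t = +-cancelˡ-< (a i + gap j) e (s' * k + t) (begin-strict
      a i + gap j + e               ≡⟨ m+[n∸m]≡n lower ⟩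
      y                             <⟨ upper ⟩
      a i + gap (suc j)             ≤⟨ +-monoʳ-≤ (a i) (gap-step j<i) ⟩
      a i + (gap j + (s' * k + t))  ≡⟨ +-assoc (a i) (gap j) (s' * k + t) ⟨
      a i + gap j + (s' * k + t)    ∎)
    regroup : ∀ aj g k e → aj + g + (k + e) ≡ aj + k + g + e
    regroup = solve-∀
    bj+[k+e]≡y : b j + (k + e) ≡ y
    bj+[k+e]≡y = begin-equality
      b j + (k + e)          ≡⟨ cong (_+ (k + e)) (b≡a+gap j) ⟩
      a j + gap j + (k + e)  ≡⟨ regroup (a j) (gap j) k e ⟩
      a j + k + gap j + e    ≡⟨ cong (λ z → z + gap j + e) aj+k≡ai ⟩
      a i + gap j + e        ≡⟨ m+[n∸m]≡n lower ⟩
      y                      ∎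
    allowed : k ≤ k + e → k + e < s * k + t
    allowed _ = subst (k + e <_) (sym (+-assoc k (s' * k) t)) (+-monoʳ-< k e<s'k+t)
    reverse-allowed : k + e ≤ k → k < s * (k + e) + t
    reverse-allowed _ = ≤-<-trans (m≤m+n k e) (n<s*n+t (k + e))

  below-pair⇒move : ∀ {i y} → a i ≤ y → y < b i → ∃ λ j → Move s t (a i) y (a j) (b j)
  below-pair⇒move {i} {y} ai≤y y<bi =
    let j , j<i , lower , upper = crossing (λ j → a i + gap j) start (subst (y <_) (b≡a+gap i) y<bi)
    in  j , crossing⇒move j<i lower upper
    where
    start : a i + gap 0 ≤ y
    start = subst (_≤ y) (sym (trans (cong (a i +_) gap-zero) (+-identityʳ (a i)))) ai≤y

  kernel-absorbing-≤ : ∀ {x y} → x ≤ y →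
                       Kernel x y ⊎ ∃₂ λ x' y' → Move s t x y x' y' × Kernel x' y'
  kernel-absorbing-≤ {x} {y} x≤y with a-or-b x
  ... | i , inj₂ refl with a i ≟ y
  ...   | yes refl = inj₁ (inj₂ (i , refl , refl))
  ...   | no  ai≢y =
    inj₂ (b i , a i , inj₂ (inj₁ (refl , ai<y)) , inj₂ (i , refl , refl))
    where
    ai<y : a i < y
    ai<y = ≤∧≢⇒< (≤-trans (a≤b i) x≤y) ai≢y
  kernel-absorbing-≤ {x} {y} x≤y | i , inj₁ refl with <-cmp y (b i)
  ... | tri≈ _ refl _ = inj₁ (inj₁ (i , refl , refl))
  ... | tri> _ _ bi<y = inj₂ (a i , b i , inj₂ (inj₁ (refl , bi<y)) , inj₁ (i , refl , refl))
  ... | tri< y<bi _ _ =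
    let j , move = below-pair⇒move {i} x≤y y<bi in inj₂ (a j , b j , move , inj₁ (j , refl , refl))

  kernel-absorbing : ∀ x y → Kernel x y ⊎ ∃₂ λ x' y' → Move s t x y x' y' × Kernel x' y'
  kernel-absorbing x y with x ≤? y
  ... | yes x≤y = kernel-absorbing-≤ x≤y
  ... | no  x≰y with kernel-absorbing-≤ (<⇒≤ (≰⇒> x≰y))
  ...   | inj₁ K                  = inj₁ (Sum.swap K)
  ...   | inj₂ (y' , x' , m , K') = inj₂ (x' , y' , Move-swap {s} {t} m , Sum.swap K')

  kernel-ordered : ∀ {x y} → x ≤ y → Kernel x y → Pair x y
  kernel-ordered _     (inj₁ P)                 = P
  kernel-ordered bi≤ai (inj₂ (i , refl , refl)) = i , sym ai≡bi , ai≡bi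
    where
    ai≡bi : a i ≡ b i
    ai≡bi = ≤-antisym (a≤b i) bi≤ai

theorem1 : (s t : ℕ) → 0 < s → 0 < t → (x y : ℕ) → x ≤ y →
    IsP s t x y ⇔ ∃ λ i → x ≡ A s t i × y ≡ B s t i
theorem1 (suc s') (suc t') _ _ x y x≤y =
  mk⇔ (kernel-ordered x≤y ∘ IsP⇒kernel) (kernel⇒IsP ∘ inj₁)
  where
  open Sequences s' t'
  open KernelCharacterisation {s} {t} Kernel kernel-stable kernel-absorbing
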